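{- Let $\mathcal{B}$ be a finite relational structure with domain $B$ and let $\mathbf{r}=(r_1,\dots,r_k)\in B^k$. Then: (i) there is a formula $\theta_{\mathbf{r}}(u_1,\dots,u_k)$ of $\{\exists,\forall,\wedge,\vee,=\}$-FO such that for all $r_1',\dots,r_k'\in B$, $\mathcal{B}\models\theta_{\mathbf{r}}(r_1',\dots,r_k')$ if and only if there is an automorphism $\pi$ of $\mathcal{B}$ with $\pi(r_i)=r_i'$ for all $i$; (ii) there is a formula $\theta_{\mathbf{r}}(u_1,\dots,u_k)$ of $\{\exists,\forall,\wedge,\vee\}$-FO such that for all $r_1',\dots,r_k'\in B$, $\mathcal{B}\models\theta_{\mathbf{r}}(r_1',\dots,r_k')$ if and only if there is a she from $(\mathcal{B},r_1,\dots,r_k)$ to $(\mathcal{B},r_1',\dots,r_k')$.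
   Context: $\mathcal{B}$ has finite domain $B$ and finite relational signature $\sigma$. $\{\exists,\forall,\wedge,\vee\}$-FO is the set of first-order formulas over $\sigma$ built from atoms $R(w_1,\dots,w_i)$ ($R\in\sigma$) using only $\wedge,\vee,\exists,\forall$; $\{\exists,\forall,\wedge,\vee,=\}$-FO additionally allows equality atoms. A shop on $B$ is a map $f:B\to\mathfrak{P}(B)\setminus\{\emptyset\}$ such that every $y\in B$ lies in $f(x)$ for some $x$. A she of $\mathcal{B}$ is a shop $f$ such that for each $R\in\sigma$ of arity $i$, $\mathcal{B}\models R(x_1,\dots,x_i)$ implies $\mathcal{B}\models R(y_1,\dots,y_i)$ for all $y_j\in f(x_j)$. A she from $(\mathcal{B},r_1,\dots,r_k)$ to $(\mathcal{B},r_1',\dots,r_k')$ is a she $f$ of $\mathcal{B}$ with $r_i'\in f(r_i)$ for all $i$. -}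

module Defs where

open import Data.Nat using (ℕ; suc)
open import Data.Fin using (Fin)
open import Data.Fin.Subset using (Subset; _∈_; Nonempty)
open import Data.Vec using (Vec; _∷_; lookup; map)
open import Data.Bool using (Bool; true; false; T)
open import Data.Product using (Σ; _×_)
open import Data.Unit using (⊤)
open import Function.Bundles using (_↔_; Inverse)
open import Relation.Binary.PropositionalEquality using (_≡_)

record Signature : Set where
  field
    nsyms : ℕ
    arity : Fin nsyms → ℕ
open Signature public

record Structure (σ : Signature) (n : ℕ) : Set where
  field
    rel : (R : Fin (nsyms σ)) → Vec (Fin n) (arity σ R) → Bool
open Structure public

-- Formulas with (at most) v free variables (de Bruijn), built from atoms with
-- ∧, ∨, ∃, ∀.  Equality atoms are available only when the flag `withEq` is true.
-- `top` is the empty conjunction.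
data Form (σ : Signature) (withEq : Bool) (v : ℕ) : Set where
  atom : (R : Fin (nsyms σ)) → Vec (Fin v) (arity σ R) → Form σ withEq v
  equ  : withEq ≡ true → Fin v → Fin v → Form σ withEq v
  top  : Form σ withEq v
  _∧'_ : Form σ withEq v → Form σ withEq v → Form σ withEq v
  _∨'_ : Form σ withEq v → Form σ withEq v → Form σ withEq v
  ∃'   : Form σ withEq (suc v) → Form σ withEq v
  ∀'   : Form σ withEq (suc v) → Form σ withEq v

Sat : ∀ {σ n e v} → Structure σ n → Form σ e v → Vec (Fin n) v → Set
Sat 𝓑 (atom R ws) ρ = T (rel 𝓑 R (map (lookup ρ) ws))
Sat 𝓑 (equ _ i j) ρ = lookup ρ i ≡ lookup ρ j
Sat 𝓑 top ρ = ⊤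
Sat 𝓑 (φ ∧' ψ) ρ = Sat 𝓑 φ ρ × Sat 𝓑 ψ ρ
Sat 𝓑 (φ ∨' ψ) ρ = Sat 𝓑 φ ρ Data.Sum.⊎ Sat 𝓑 ψ ρ
  where import Data.Sum
Sat 𝓑 (∃' φ) ρ = Σ (Fin _) λ b → Sat 𝓑 φ (b ∷ ρ)
Sat 𝓑 (∀' φ) ρ = (b : Fin _) → Sat 𝓑 φ (b ∷ ρ)

record Automorphism {σ n} (𝓑 : Structure σ n) : Set where
  field
    perm : Fin n ↔ Fin n
    preserves : ∀ R (xs : Vec (Fin n) (arity σ R)) →
                rel 𝓑 R (map (Inverse.to perm) xs) ≡ rel 𝓑 R xs
open Automorphism public

IsShop : ∀ {n} → (Fin n → Subset n) → Set
IsShop {n} f = (∀ x → Nonempty (f x)) × (∀ (y : Fin n) → Σ (Fin n) λ x → y ∈ f x)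

IsShe : ∀ {σ n} → Structure σ n → (Fin n → Subset n) → Set
IsShe {σ} {n} 𝓑 f = IsShop f ×
  (∀ R (xs ys : Vec (Fin n) (arity σ R)) → T (rel 𝓑 R xs) →
     (∀ j → lookup ys j ∈ f (lookup xs j)) → T (rel 𝓑 R ys))

SheFromTo : ∀ {σ n k} → Structure σ n → Vec (Fin n) k → Vec (Fin n) k → Set
SheFromTo {n = n} 𝓑 r r' = Σ (Fin n → Subset n) λ f →
  IsShe 𝓑 f × (∀ i → lookup r' i ∈ f (lookup r i))

module Submission where

-- (i) θ says: there are x_b (b ∈ B) such that b ↦ x_b preserves every atom of the positive
-- diagram of 𝓑, sends r to u, and is onto.  A surjective endomorphism of a finite structure is a
-- permutation, hence of finite order, so its inverse is one of its iterates and also preserves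
-- the relations: it is an automorphism.
-- (ii) θ says: there are x_b such that for all y_1 … y_n there are c_1 … c_n for which the pairs
-- (c_j, y_j), (b, x_b), (r_i, u_i) jointly preserve every relation.  The she is
-- b ↦ {y | (b, y) is among these pairs}: x_b makes f(b) nonempty, and taking y_j = j makes f onto.
-- Conversely, a she supplies x_b ∈ f(b) and preimages c_j with y_j ∈ f(c_j).

open import Defs
open import Data.Bool using (Bool; true; false; T; if_then_else_)
open import Data.Bool.Properties using (T-≡; ⇔→≡)
open import Data.Fin using (Fin; zero; suc; toℕ; _↑ˡ_; _↑ʳ_)
open import Data.Fin.Properties using (pigeonhole; toℕ≤pred[n]; any?; _≟_; ∀-cons-⇔; ⊎⇔∃)
open import Data.Fin.Subset using (Subset; _∈_; Nonempty)
open import Data.Nat using (ℕ; zero; suc; _+_; _*_; _∸_; _≤_; _!; pred)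
open import Data.Nat.Divisibility using (_∣_; divides; ∣-trans; m∣m*n; m≤n⇒m!∣n!)
open import Data.Nat.Properties using (+-suc; m+[n∸m]≡n; n<1+n; m≤n+m; ≤-trans; suc-pred; _!≢0)
open import Data.Product using (Σ; ∃; _×_; _,_; proj₁; proj₂)
open import Data.Product.Function.NonDependent.Propositional using (_×-⇔_)
open import Data.Sum.Function.Propositional using (_⊎-⇔_)
open import Data.Unit using (tt)
open import Data.Vec using (Vec; []; _∷_; lookup; map; _++_; tabulate; allFin)
open import Data.Vec.Properties
  using (lookup-++ˡ; lookup-++ʳ; lookup-allFin; lookup∘tabulate; lookup-map; map-cong; map-id; map-∘;
         lookup⇒[]=; []=⇒lookup)
open import Data.Vec.Relation.Binary.Pointwise.Extensional using (ext; extensional⇒inductive)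
open import Data.Vec.Relation.Binary.Pointwise.Inductive as Pointwise
  using (Pointwise; ++⁺; tabulate⁺; Pointwise-≡⇒≡)
open import Function using (_∘_)
open import Function.Bundles using (_⇔_; mk⇔; module Equivalence; Inverse; mk↔ₛ′)
open import Function.Construct.Composition using (_⇔-∘_)
open import Function.Construct.Identity using (⇔-id)
open import Function.Construct.Symmetry using (⇔-sym)
open import Function.Definitions using (Injective)
import Function.Endo.Propositional as Endo
open import Relation.Binary.PropositionalEquality
  using (_≡_; refl; sym; trans; cong; cong-app; subst; module ≡-Reasoning)
open import Relation.Nullary using (Dec; ⌊_⌋)
open import Relation.Nullary.Decidable using (toWitness; fromWitness; _×-dec_; map′)

open Equivalence using (to; from)

T-injective : ∀ {a b} → T a ⇔ T b → a ≡ b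
T-injective Ta⇔Tb = ⇔→≡ (T-≡ ⇔-∘ (Ta⇔Tb ⇔-∘ ⇔-sym T-≡))

pointwise : ∀ {A B : Set} {S : A → B → Set} {m} {xs : Vec A m} {ys : Vec B m} →
            (∀ i → S (lookup xs i) (lookup ys i)) → Pointwise S xs ys
pointwise = extensional⇒inductive ∘ ext

module _ {A : Set} where
  open Endo A using (_^_; ^-homo)

  ^-+ : ∀ (f : A → A) p q x → (f ^ (p + q)) x ≡ (f ^ p) ((f ^ q) x)
  ^-+ f p q = cong-app (^-homo f p q)

  ^-sucʳ : ∀ (f : A → A) q x → (f ^ suc q) x ≡ (f ^ q) (f x)
  ^-sucʳ f zero    x = refl
  ^-sucʳ f (suc q) x = cong f (^-sucʳ f q x)

  ^-injective : ∀ {f : A → A} → Injective _≡_ _≡_ f → ∀ q → Injective _≡_ _≡_ (f ^ q)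
  ^-injective f-inj zero    eq = eq
  ^-injective f-inj (suc q) eq = ^-injective f-inj q (f-inj eq)

  ^-fixes-* : ∀ {f : A → A} {p x} → (f ^ p) x ≡ x → ∀ q → (f ^ (q * p)) x ≡ x
  ^-fixes-* fᵖx≡x zero = refl
  ^-fixes-* {f} {p} {x} fᵖx≡x (suc q) = begin
    (f ^ (p + q * p)) x     ≡⟨ ^-+ f p (q * p) x ⟩
    (f ^ p) ((f ^ (q * p)) x) ≡⟨ cong (f ^ p) (^-fixes-* fᵖx≡x q) ⟩
    (f ^ p) x               ≡⟨ fᵖx≡x ⟩
    x                       ∎
    where open ≡-Reasoning

  ^-fixes-∣ : ∀ {f : A → A} {p N x} → (f ^ p) x ≡ x → p ∣ N → (f ^ N) x ≡ x
  ^-fixes-∣ fᵖx≡x (divides q refl) = ^-fixes-* fᵖx≡x q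

  ^-rightInverse : ∀ {g h : A → A} → (∀ y → g (h y) ≡ y) → ∀ q y → (g ^ q) ((h ^ q) y) ≡ y
  ^-rightInverse g∘h zero    y = refl
  ^-rightInverse {g} {h} g∘h (suc q) y = begin
    g ((g ^ q) ((h ^ suc q) y)) ≡⟨ cong (g ∘ (g ^ q)) (^-sucʳ h q y) ⟩
    g ((g ^ q) ((h ^ q) (h y))) ≡⟨ cong g (^-rightInverse g∘h q (h y)) ⟩
    g (h y)                     ≡⟨ g∘h y ⟩
    y                           ∎
    where open ≡-Reasoning

module _ {n : ℕ} {h : Fin n → Fin n} (h-injective : Injective _≡_ _≡_ h) where
  open Endo (Fin n) using (_^_)

  -- Two of the iterates h⁰x, …, hⁿx coincide; cancelling the smaller power leaves a period ≤ n.
  periodic-point : ∀ x → ∃ λ p → suc p ≤ n × (h ^ suc p) x ≡ x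
  periodic-point x with i , j , i<j , hⁱx≡hʲx ← pigeonhole (n<1+n n) (λ i → (h ^ toℕ i) x) =
    p , ≤-trans (m≤n+m (suc p) (toℕ i)) (subst (_≤ n) (sym i+p≡j) (toℕ≤pred[n] j)) ,
    ^-injective h-injective (toℕ i) (begin
      (h ^ toℕ i) ((h ^ suc p) x) ≡⟨ ^-+ h (toℕ i) (suc p) x ⟨
      (h ^ (toℕ i + suc p)) x     ≡⟨ cong (λ t → (h ^ t) x) i+p≡j ⟩
      (h ^ toℕ j) x               ≡⟨ hⁱx≡hʲx ⟨
      (h ^ toℕ i) x               ∎)
    where
    open ≡-Reasoning
    p = toℕ j ∸ suc (toℕ i)
    i+p≡j : toℕ i + suc p ≡ toℕ j
    i+p≡j = trans (+-suc (toℕ i) p) (m+[n∸m]≡n i<j)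

  ^-n!-fixes : ∀ x → (h ^ (n !)) x ≡ x
  ^-n!-fixes x with p , 1+p≤n , hᵖx≡x ← periodic-point x =
    ^-fixes-∣ hᵖx≡x (∣-trans (m∣m*n {suc p} (p !)) (m≤n⇒m!∣n! 1+p≤n))

module _ {σ : Signature} {e : Bool} where

  ⋀ : ∀ {v m} → (Fin m → Form σ e v) → Form σ e v
  ⋀ {m = zero}  φ = top
  ⋀ {m = suc m} φ = φ zero ∧' ⋀ (φ ∘ suc)

  -- The empty disjunction is junk (`top`); Sat-⋁ therefore assumes Fin m inhabited.
  ⋁ : ∀ {v m} → (Fin m → Form σ e v) → Form σ e v
  ⋁ {m = zero}        φ = top
  ⋁ {m = suc zero}    φ = φ zero
  ⋁ {m = suc (suc m)} φ = φ zero ∨' ⋁ (φ ∘ suc)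

  ⋀ⱽ : ∀ {v m a} → (Vec (Fin m) a → Form σ e v) → Form σ e v
  ⋀ⱽ {a = zero}  φ = φ []
  ⋀ⱽ {a = suc a} φ = ⋀ λ i → ⋀ⱽ (φ ∘ (i ∷_))

  ⋁ⱽ : ∀ {v m a} → (Vec (Fin m) a → Form σ e v) → Form σ e v
  ⋁ⱽ {a = zero}  φ = φ []
  ⋁ⱽ {a = suc a} φ = ⋁ λ i → ⋁ⱽ (φ ∘ (i ∷_))

  ∃ⁿ : ∀ {v} m → Form σ e (m + v) → Form σ e v
  ∃ⁿ zero    φ = φ
  ∃ⁿ (suc m) φ = ∃ⁿ m (∃' φ)

  ∀ⁿ : ∀ {v} m → Form σ e (m + v) → Form σ e v
  ∀ⁿ zero    φ = φ
  ∀ⁿ (suc m) φ = ∀ⁿ m (∀' φ)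

module _ {σ : Signature} {n : ℕ} (𝓑 : Structure σ n) {e : Bool} where

  Sat-⋀ : ∀ {v m} (φ : Fin m → Form σ e v) {ρ} → Sat 𝓑 (⋀ φ) ρ ⇔ (∀ i → Sat 𝓑 (φ i) ρ)
  Sat-⋀ {m = zero}  φ = mk⇔ (λ _ ()) (λ _ → tt)
  Sat-⋀ {m = suc m} φ = ∀-cons-⇔ ⇔-∘ (⇔-id _ ×-⇔ Sat-⋀ (φ ∘ suc))

  Sat-⋁ : ∀ {v m} (φ : Fin m → Form σ e v) {ρ} → Fin m → Sat 𝓑 (⋁ φ) ρ ⇔ ∃ λ i → Sat 𝓑 (φ i) ρ
  Sat-⋁ {m = suc zero}    φ _ = mk⇔ (zero ,_) λ { (zero , s) → s }
  Sat-⋁ {m = suc (suc m)} φ _ = ⊎⇔∃ ⇔-∘ (⇔-id _ ⊎-⇔ Sat-⋁ (φ ∘ suc) zero)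

  Sat-⋀ⱽ : ∀ {v m a} (φ : Vec (Fin m) a → Form σ e v) {ρ} →
           Sat 𝓑 (⋀ⱽ φ) ρ ⇔ (∀ w → Sat 𝓑 (φ w) ρ)
  Sat-⋀ⱽ {a = zero}  φ = mk⇔ (λ { s [] → s }) (λ all → all [])
  Sat-⋀ⱽ {a = suc a} φ = mk⇔
    (λ { s (i ∷ w) → to (Sat-⋀ⱽ (φ ∘ (i ∷_))) (to (Sat-⋀ _) s i) w })
    (λ all → from (Sat-⋀ _) λ i → from (Sat-⋀ⱽ (φ ∘ (i ∷_))) (all ∘ (i ∷_)))

  Sat-⋁ⱽ : ∀ {v m a} (φ : Vec (Fin m) a → Form σ e v) {ρ} → Vec (Fin m) a →
           Sat 𝓑 (⋁ⱽ φ) ρ ⇔ ∃ λ w → Sat 𝓑 (φ w) ρ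
  Sat-⋁ⱽ φ [] = mk⇔ ([] ,_) λ { ([] , s) → s }
  Sat-⋁ⱽ φ {ρ} (i₀ ∷ w₀) = mk⇔
    (λ s → let i , sᵢ = to (Sat-⋁ _ {ρ} i₀) s
               w , s′ = to (Sat-⋁ⱽ (φ ∘ (i ∷_)) {ρ} w₀) sᵢ
           in i ∷ w , s′)
    (λ { (i ∷ w , s) → from (Sat-⋁ _ i₀) (i , from (Sat-⋁ⱽ (φ ∘ (i ∷_)) w₀) (w , s)) })

  Sat-∃ⁿ : ∀ {v} m (φ : Form σ e (m + v)) {ρ} → Sat 𝓑 (∃ⁿ m φ) ρ ⇔ ∃ λ xs → Sat 𝓑 φ (xs ++ ρ)
  Sat-∃ⁿ zero    φ = mk⇔ ([] ,_) λ { ([] , s) → s }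
  Sat-∃ⁿ (suc m) φ {ρ} = mk⇔
    ((λ { (xs , b , s) → b ∷ xs , s }) ∘ to (Sat-∃ⁿ m (∃' φ) {ρ}))
    (λ { (b ∷ xs , s) → from (Sat-∃ⁿ m (∃' φ)) (xs , b , s) })

  Sat-∀ⁿ : ∀ {v} m (φ : Form σ e (m + v)) {ρ} → Sat 𝓑 (∀ⁿ m φ) ρ ⇔ (∀ xs → Sat 𝓑 φ (xs ++ ρ))
  Sat-∀ⁿ zero    φ = mk⇔ (λ { s [] → s }) (λ all → all [])
  Sat-∀ⁿ (suc m) φ = mk⇔
    (λ { s (b ∷ xs) → to (Sat-∀ⁿ m (∀' φ)) s xs b })
    (λ all → from (Sat-∀ⁿ m (∀' φ)) λ xs b → all (b ∷ xs))

module _ {n : ℕ} where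

  record Linked {V} (lab ρ : Vec (Fin n) V) (b y : Fin n) : Set where
    constructor linked
    field
      position : Fin V
      lab≡     : lookup lab position ≡ b
      ρ≡       : lookup ρ position ≡ y

  linked-++ˡ : ∀ {V V′} {lab ρ : Vec (Fin n) V} (lab′ ρ′ : Vec (Fin n) V′) {b y} →
               Linked lab ρ b y → Linked (lab ++ lab′) (ρ ++ ρ′) b y
  linked-++ˡ {lab = lab} {ρ} lab′ ρ′ (linked v refl refl) =
    linked (v ↑ˡ _) (lookup-++ˡ lab lab′ v) (lookup-++ˡ ρ ρ′ v)

  linked-++ʳ : ∀ {V V′} (lab ρ : Vec (Fin n) V) {lab′ ρ′ : Vec (Fin n) V′} {b y} →
               Linked lab′ ρ′ b y → Linked (lab ++ lab′) (ρ ++ ρ′) b y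
  linked-++ʳ {V} lab ρ {lab′} {ρ′} (linked v refl refl) =
    linked (V ↑ʳ v) (lookup-++ʳ lab lab′ v) (lookup-++ʳ ρ ρ′ v)

  pointwise⇒linked⊆ : ∀ {V} {lab ρ : Vec (Fin n) V} {S : Fin n → Fin n → Set} →
                      Pointwise S lab ρ → ∀ {b y} → Linked lab ρ b y → S b y
  pointwise⇒linked⊆ lab~ρ (linked v refl refl) = Pointwise.lookup lab~ρ v

  linked-tuples⇒index-tuple : ∀ {V a} {lab ρ : Vec (Fin n) V} (xs ys : Vec (Fin n) a) →
                  (∀ j → Linked lab ρ (lookup xs j) (lookup ys j)) →
                  ∃ λ w → map (lookup lab) w ≡ xs × map (lookup ρ) w ≡ ys
  linked-tuples⇒index-tuple [] [] _ = [] , refl , refl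
  linked-tuples⇒index-tuple (x ∷ xs) (y ∷ ys) xs~ys
    with xs~ys zero | linked-tuples⇒index-tuple xs ys (xs~ys ∘ suc)
  ... | linked v refl refl | w , refl , refl = v ∷ w , refl , refl

  linked? : ∀ {V} (lab ρ : Vec (Fin n) V) b y → Dec (Linked lab ρ b y)
  linked? lab ρ b y = map′ (λ (v , p , q) → linked v p q) (λ (linked v p q) → v , p , q)
                           (any? λ v → (lookup lab v ≟ b) ×-dec (lookup ρ v ≟ y))

  linkedSubset : ∀ {V} → Vec (Fin n) V → Vec (Fin n) V → Fin n → Subset n
  linkedSubset lab ρ b = tabulate λ y → ⌊ linked? lab ρ b y ⌋

  ∈-linkedSubset : ∀ {V} (lab ρ : Vec (Fin n) V) {b y} → y ∈ linkedSubset lab ρ b ⇔ Linked lab ρ b y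
  ∈-linkedSubset lab ρ {b} {y} = mk⇔
    (λ y∈ → toWitness {a? = linked? lab ρ b y}
              (from T-≡ (trans (sym (lookup∘tabulate _ y)) ([]=⇒lookup y∈))))
    (λ lab~ρ → lookup⇒[]= y _ (trans (lookup∘tabulate _ y) (to T-≡ (fromWitness lab~ρ))))

module _ {σ : Signature} {n : ℕ} (𝓑 : Structure σ n) where
  open Endo (Fin n) using (_^_)

  PreservesRelations : (Fin n → Fin n → Set) → Set
  PreservesRelations S = ∀ R (xs ys : Vec (Fin n) (arity σ R)) → T (rel 𝓑 R xs) →
                         (∀ j → S (lookup xs j) (lookup ys j)) → T (rel 𝓑 R ys)

  preserves-⊆ : ∀ {S S′ : Fin n → Fin n → Set} → (∀ {x y} → S x y → S′ x y) →
                PreservesRelations S′ → PreservesRelations S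
  preserves-⊆ S⊆S′ S′-preserves R xs ys t xs~ys = S′-preserves R xs ys t (S⊆S′ ∘ xs~ys)

  IsEndomorphism : (Fin n → Fin n) → Set
  IsEndomorphism g = ∀ R xs → T (rel 𝓑 R xs) → T (rel 𝓑 R (map g xs))

  isEndomorphism⇔preserves-graph : ∀ {g} → IsEndomorphism g ⇔ PreservesRelations (λ x y → g x ≡ y)
  isEndomorphism⇔preserves-graph {g} = mk⇔
    (λ endo R xs ys t gxs≡ys →
       subst (T ∘ rel 𝓑 R) (Pointwise-≡⇒≡ (pointwise λ j → trans (lookup-map j g xs) (gxs≡ys j)))
             (endo R xs t))
    (λ preserves R xs t → preserves R xs (map g xs) t λ j → sym (lookup-map j g xs))

  ^-isEndomorphism : ∀ {g} → IsEndomorphism g → ∀ q → IsEndomorphism (g ^ q)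
  ^-isEndomorphism endo zero    R xs t = subst (T ∘ rel 𝓑 R) (sym (map-id xs)) t
  ^-isEndomorphism {g} endo (suc q) R xs t =
    subst (T ∘ rel 𝓑 R) (sym (map-∘ g (g ^ q) xs)) (endo R _ (^-isEndomorphism endo q R xs t))

  -- The inverse of g is an iterate of g (g has finite order), so g also reflects the relations.
  surjective-endomorphism⇒automorphism :
    ∀ g → (∀ y → ∃ λ x → g x ≡ y) → IsEndomorphism g →
    Σ (Automorphism 𝓑) λ π → ∀ x → Inverse.to (perm π) x ≡ g x
  surjective-endomorphism⇒automorphism g g-surjective g-endo = π , λ _ → refl
    where
    h = proj₁ ∘ g-surjective
    g∘h : ∀ y → g (h y) ≡ y
    g∘h = proj₂ ∘ g-surjective
    h-injective : Injective _≡_ _≡_ h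
    h-injective {a} {b} ha≡hb = trans (sym (g∘h a)) (trans (cong g ha≡hb) (g∘h b))
    m = pred (n !)
    g-order : ∀ x → (g ^ suc m) x ≡ x
    g-order x = begin
      (g ^ suc m) x               ≡⟨ cong (λ t → (g ^ t) x) (suc-pred (n !) {{n !≢0}}) ⟩
      (g ^ (n !)) x               ≡⟨ cong (g ^ (n !)) (^-n!-fixes h-injective x) ⟨
      (g ^ (n !)) ((h ^ (n !)) x) ≡⟨ ^-rightInverse g∘h (n !) x ⟩
      x                           ∎
      where open ≡-Reasoning
    g⁻¹∘g : ∀ x → (g ^ m) (g x) ≡ x
    g⁻¹∘g x = trans (sym (^-sucʳ g m x)) (g-order x)
    reflects : ∀ R xs → T (rel 𝓑 R (map g xs)) → T (rel 𝓑 R xs)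
    reflects R xs t = subst (T ∘ rel 𝓑 R)
      (trans (sym (map-∘ (g ^ m) g xs)) (trans (map-cong g⁻¹∘g xs) (map-id xs)))
      (^-isEndomorphism g-endo m R (map g xs) t)
    π : Automorphism 𝓑
    π = record
      { perm      = mk↔ₛ′ g (g ^ m) g-order g⁻¹∘g
      ; preserves = λ R xs → T-injective (mk⇔ (reflects R xs) (g-endo R xs))
      }

  atomIf : ∀ {e V} → Vec (Fin n) V → ∀ R → Vec (Fin V) (arity σ R) → Form σ e V
  atomIf lab R w = if rel 𝓑 R (map (lookup lab) w) then atom R w else top

  -- The positive diagram of 𝓑 in which variable v names the element lab v.
  diagram : ∀ {e V} → Vec (Fin n) V → Form σ e V
  diagram lab = ⋀ λ R → ⋀ⱽ λ w → atomIf lab R w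

  Sat-atomIf : ∀ {e V} (lab ρ : Vec (Fin n) V) R w →
               Sat 𝓑 (atomIf {e} lab R w) ρ ⇔
               (T (rel 𝓑 R (map (lookup lab) w)) → T (rel 𝓑 R (map (lookup ρ) w)))
  Sat-atomIf lab ρ R w with rel 𝓑 R (map (lookup lab) w)
  ... | true  = mk⇔ (λ s _ → s) (λ atom-preserved → atom-preserved tt)
  ... | false = mk⇔ (λ _ ()) (λ _ → tt)

  Sat-diagram : ∀ {e V} (lab ρ : Vec (Fin n) V) →
                Sat 𝓑 (diagram {e} lab) ρ ⇔ PreservesRelations (Linked lab ρ)
  Sat-diagram lab ρ = mk⇔ sound complete
    where
    sound : Sat 𝓑 (diagram lab) ρ → PreservesRelations (Linked lab ρ)
    sound s R xs ys t xs~ys with linked-tuples⇒index-tuple xs ys xs~ys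
    ... | w , refl , refl = to (Sat-atomIf lab ρ R w) (to (Sat-⋀ⱽ 𝓑 _) (to (Sat-⋀ 𝓑 _) s R) w) t
    complete : PreservesRelations (Linked lab ρ) → Sat 𝓑 (diagram lab) ρ
    complete preserves = from (Sat-⋀ 𝓑 _) λ R → from (Sat-⋀ⱽ 𝓑 _) λ w → from (Sat-atomIf lab ρ R w)
      λ t → preserves R _ _ t λ j → linked (lookup w j) (sym (lookup-map j _ w)) (sym (lookup-map j _ w))

module _ {σ : Signature} {n : ℕ} (𝓑 : Structure σ n) {k : ℕ} (r : Vec (Fin n) k) where

  AutomorphismFromTo : Vec (Fin n) k → Set
  AutomorphismFromTo r′ = Σ (Automorphism 𝓑) λ π → ∀ i → Inverse.to (perm π) (lookup r i) ≡ lookup r′ i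

  -- Over the variables x ++ u, the element x_b is variable b ↑ˡ k and u_i is variable n ↑ʳ i.
  sends-r : Fin k → Form σ true (n + k)
  sends-r i = equ refl (n ↑ʳ i) (lookup r i ↑ˡ k)

  hits : Fin n → Form σ true (suc (n + k))
  hits b = equ refl zero (suc (b ↑ˡ k))

  surjectiveEndomorphismFormula : Form σ true (n + k)
  surjectiveEndomorphismFormula = diagram 𝓑 (allFin n ++ r) ∧' (⋀ sends-r ∧' ∀' (⋁ hits))

  SurjectiveEndomorphismFromTo : (Fin n → Fin n) → Vec (Fin n) k → Set
  SurjectiveEndomorphismFromTo g r′ =
    IsEndomorphism 𝓑 g × (∀ y → ∃ λ b → g b ≡ y) × (∀ i → g (lookup r i) ≡ lookup r′ i)

  Sat-surjectiveEndomorphismFormula :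
    ∀ xs r′ → Sat 𝓑 surjectiveEndomorphismFormula (xs ++ r′) ⇔
              SurjectiveEndomorphismFromTo (lookup xs) r′
  Sat-surjectiveEndomorphismFormula xs r′ = mk⇔ sound complete
    where
    open ≡-Reasoning
    sends-r⇔ : ∀ i → Sat 𝓑 (sends-r i) (xs ++ r′) ⇔ (lookup xs (lookup r i) ≡ lookup r′ i)
    sends-r⇔ i = mk⇔
      (λ s → begin
        lookup xs (lookup r i)               ≡⟨ lookup-++ˡ xs r′ _ ⟨
        lookup (xs ++ r′) (lookup r i ↑ˡ k) ≡⟨ s ⟨
        lookup (xs ++ r′) (n ↑ʳ i)          ≡⟨ lookup-++ʳ xs r′ i ⟩
        lookup r′ i                          ∎)
      (λ gr≡r′ → trans (lookup-++ʳ xs r′ i) (trans (sym gr≡r′) (sym (lookup-++ˡ xs r′ _))))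
    graph-on-allFin : Pointwise (λ x y → lookup xs x ≡ y) (allFin n) xs
    graph-on-allFin = pointwise λ b → cong (lookup xs) (lookup-allFin b)
    graph⊆linked : ∀ {b y} → lookup xs b ≡ y → Linked (allFin n ++ r) (xs ++ r′) b y
    graph⊆linked {b} refl = linked-++ˡ r r′ (linked b (lookup-allFin b) refl)
    sound : Sat 𝓑 surjectiveEndomorphismFormula (xs ++ r′) →
            SurjectiveEndomorphismFromTo (lookup xs) r′
    sound (d , s-sends , s-hits) =
      from (isEndomorphism⇔preserves-graph 𝓑)
           (preserves-⊆ 𝓑 {S = λ b y → lookup xs b ≡ y} graph⊆linked
                         (to (Sat-diagram 𝓑 (allFin n ++ r) (xs ++ r′)) d)) ,
      (λ y → let b , y≡xᵦ = to (Sat-⋁ 𝓑 _ y) (s-hits y) in b , sym (trans y≡xᵦ (lookup-++ˡ xs r′ b))) ,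
      (λ i → to (sends-r⇔ i) (to (Sat-⋀ 𝓑 _) s-sends i))
    complete : SurjectiveEndomorphismFromTo (lookup xs) r′ →
               Sat 𝓑 surjectiveEndomorphismFormula (xs ++ r′)
    complete (endo , surjective , gr≡r′) =
      from (Sat-diagram 𝓑 (allFin n ++ r) (xs ++ r′))
        (preserves-⊆ 𝓑 {S′ = λ b y → lookup xs b ≡ y}
                       (pointwise⇒linked⊆ (++⁺ graph-on-allFin (pointwise gr≡r′)))
                       (to (isEndomorphism⇔preserves-graph 𝓑) endo)) ,
      from (Sat-⋀ 𝓑 _) (λ i → from (sends-r⇔ i) (gr≡r′ i)) ,
      λ y → from (Sat-⋁ 𝓑 _ y)
                 (let b , xᵦ≡y = surjective y in b , sym (trans (lookup-++ˡ xs r′ b) xᵦ≡y))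

  automorphismFormula : Form σ true k
  automorphismFormula = ∃ⁿ n surjectiveEndomorphismFormula

  Sat-automorphismFormula : ∀ r′ → Sat 𝓑 automorphismFormula r′ ⇔ AutomorphismFromTo r′
  Sat-automorphismFormula r′ = mk⇔ sound complete
    where
    sound : Sat 𝓑 automorphismFormula r′ → AutomorphismFromTo r′
    sound s with xs , body ← to (Sat-∃ⁿ 𝓑 n _) s
            with endo , surjective , gr≡r′ ← to (Sat-surjectiveEndomorphismFormula xs r′) body
            with π , π≗g ← surjective-endomorphism⇒automorphism 𝓑 (lookup xs) surjective endo =
      π , λ i → trans (π≗g (lookup r i)) (gr≡r′ i)
    complete : AutomorphismFromTo r′ → Sat 𝓑 automorphismFormula r′
    complete (π , πr≡r′) =
      from (Sat-∃ⁿ 𝓑 n _)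
           (xs , from (Sat-surjectiveEndomorphismFormula xs r′) (endo , surjective , gr≡r′))
      where
      g = Inverse.to (perm π)
      xs = tabulate g
      endo : IsEndomorphism 𝓑 (lookup xs)
      endo R ys t = subst (T ∘ rel 𝓑 R) (sym (map-cong (lookup∘tabulate g) ys))
                          (subst T (sym (preserves π R ys)) t)
      surjective : ∀ y → ∃ λ b → lookup xs b ≡ y
      surjective y = Inverse.from (perm π) y ,
                     trans (lookup∘tabulate g _) (Inverse.strictlyInverseˡ (perm π) y)
      gr≡r′ : ∀ i → lookup xs (lookup r i) ≡ lookup r′ i
      gr≡r′ i = trans (lookup∘tabulate g _) (πr≡r′ i)

  sheDisjunct : Vec (Fin n) n → Form σ false (n + (n + k))
  sheDisjunct c = diagram 𝓑 (c ++ allFin n ++ r)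

  sheBody : Form σ false (n + (n + k))
  sheBody = ⋁ⱽ sheDisjunct

  sheFormula : Form σ false k
  sheFormula = ∃ⁿ n (∀ⁿ n sheBody)

  linkedSubset-isShe : ∀ {r′} (xs c : Vec (Fin n) n) →
    PreservesRelations 𝓑 (Linked (c ++ allFin n ++ r) (allFin n ++ xs ++ r′)) →
    SheFromTo 𝓑 r r′
  linkedSubset-isShe {r′} xs c preserves =
    f , ((nonempty , covered) , preserves-⊆ 𝓑 {S = λ b y → y ∈ f b} (to ∈f) preserves) , r′∈f
    where
    lab = c ++ allFin n ++ r
    ρ = allFin n ++ xs ++ r′
    f = linkedSubset lab ρ
    ∈f : ∀ {b y} → y ∈ f b ⇔ Linked lab ρ b y
    ∈f = ∈-linkedSubset lab ρ
    nonempty : ∀ b → Nonempty (f b)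
    nonempty b = lookup xs b ,
      from ∈f (linked-++ʳ c (allFin n) (linked-++ˡ r r′ (linked b (lookup-allFin b) refl)))
    covered : ∀ y → ∃ λ b → y ∈ f b
    covered y = lookup c y ,
      from ∈f (linked-++ˡ (allFin n ++ r) (xs ++ r′)
                          (linked {lab = c} {ρ = allFin n} y refl (lookup-allFin y)))
    r′∈f : ∀ i → lookup r′ i ∈ f (lookup r i)
    r′∈f i = from ∈f (linked-++ʳ c (allFin n) (linked-++ʳ (allFin n) xs (linked i refl refl)))

  Sat-sheFormula : ∀ r′ → Sat 𝓑 sheFormula r′ ⇔ SheFromTo 𝓑 r r′
  Sat-sheFormula r′ = mk⇔ sound complete
    where
    sound : Sat 𝓑 sheFormula r′ → SheFromTo 𝓑 r r′
    sound s with xs , all-ys ← to (Sat-∃ⁿ 𝓑 n (∀ⁿ n sheBody)) s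
            with c , d ← to (Sat-⋁ⱽ 𝓑 sheDisjunct (allFin n))
                            (to (Sat-∀ⁿ 𝓑 n sheBody) all-ys (allFin n)) =
      linkedSubset-isShe xs c (to (Sat-diagram 𝓑 (c ++ allFin n ++ r) (allFin n ++ xs ++ r′)) d)
    complete : SheFromTo 𝓑 r r′ → Sat 𝓑 sheFormula r′
    complete (f , ((nonempty , covered) , f-preserves) , r′∈f) =
      from (Sat-∃ⁿ 𝓑 n (∀ⁿ n sheBody)) (xs , from (Sat-∀ⁿ 𝓑 n sheBody) λ ys →
        from (Sat-⋁ⱽ 𝓑 sheDisjunct ys) (preimages ys , from (Sat-diagram 𝓑 _ (ys ++ xs ++ r′))
          (preserves-⊆ 𝓑 {S′ = Related}
                       (pointwise⇒linked⊆ (++⁺ (preimages-related ys) (++⁺ xs-related r′-related)))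
                       f-preserves)))
      where
      Related : Fin n → Fin n → Set
      Related b y = y ∈ f b
      xs = tabulate (proj₁ ∘ nonempty)
      preimages : Vec (Fin n) n → Vec (Fin n) n
      preimages = map (proj₁ ∘ covered)
      preimages-related : ∀ ys → Pointwise Related (preimages ys) ys
      preimages-related ys = pointwise λ j →
        subst (λ b → lookup ys j ∈ f b) (sym (lookup-map j _ ys)) (proj₂ (covered (lookup ys j)))
      xs-related : Pointwise Related (allFin n) xs
      xs-related = tabulate⁺ (proj₂ ∘ nonempty)
      r′-related : Pointwise Related r r′
      r′-related = pointwise r′∈f

lemma2p1 : ∀ {σ : Signature} {n : ℕ} (𝓑 : Structure σ n) (k : ℕ) (r : Vec (Fin n) k) →
  (Σ (Form σ true k) λ θ → ∀ (r' : Vec (Fin n) k) →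
      Sat 𝓑 θ r' ⇔ (Σ (Automorphism 𝓑) λ π → ∀ i → Inverse.to (perm π) (lookup r i) ≡ lookup r' i))
  × (Σ (Form σ false k) λ θ → ∀ (r' : Vec (Fin n) k) →
      Sat 𝓑 θ r' ⇔ SheFromTo 𝓑 r r')
lemma2p1 𝓑 k r =
  (automorphismFormula 𝓑 r , Sat-automorphismFormula 𝓑 r) , (sheFormula 𝓑 r , Sat-sheFormula 𝓑 r)
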